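{- There is $p=O(\log n)$ such that $D^{p}(\textsc{IndSub}(\text{co- }P_3))=\tilde O(n)$.
   Context: $\text{co- }P_3$ is the complement of the path on three vertices. Insertion-only graph streaming model: the edges of an $n$-vertex undirected simple graph $G$ arrive as a stream in arbitrary order; the algorithm knows $n$, makes $p$ passes, and has bounded memory (bits). $\textsc{IndSub}(H)$: decide whether $G$ contains an induced subgraph isomorphic to $H$ (outputting its vertex set if so). $D^p(\cdot)$ is the minimum space of a deterministic $p$-pass streaming algorithm for the problem. $\tilde O$ hides polylogarithmic factors in $n$. -}

module Defs where

open import Data.Nat using (ℕ; zero; suc)
open import Data.Fin using (Fin; zero; suc)
open import Data.Fin.Subset using (Subset; _∈_)
open import Data.Bool using (Bool)
open import Data.Vec using (Vec)
open import Data.List using (List; foldl)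
open import Data.List.Relation.Unary.All using (All)
open import Data.List.Relation.Unary.AllPairs using (AllPairs)
open import Data.List.Membership.Propositional using () renaming (_∈_ to _∈ₗ_)
open import Data.Maybe using (Maybe; just; nothing)
open import Data.Product using (Σ; _×_; _,_; proj₁; proj₂)
open import Data.Sum using (_⊎_)
open import Data.Unit using (⊤)
open import Data.Empty using (⊥)
open import Relation.Nullary using (¬_)
open import Relation.Binary.PropositionalEquality using (_≡_; _≢_)
open import Function.Definitions using (Injective)
open import Function.Bundles using (_⇔_)

-- A stream element: an (undirected) edge, presented as a pair of endpoints
-- in an arbitrary orientation.
Edge : ℕ → Set
Edge n = Fin n × Fin n

SameEdge : ∀ {n} → Edge n → Edge n → Set
SameEdge (u , v) (u' , v') = (u ≡ u' × v ≡ v') ⊎ (u ≡ v' × v ≡ u')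

ValidStream : ∀ {n} → List (Edge n) → Set
ValidStream es = All (λ e → proj₁ e ≢ proj₂ e) es
               × AllPairs (λ e e' → ¬ SameEdge e e') es

Adj : ∀ {n} → List (Edge n) → Fin n → Fin n → Set
Adj es u v = ((u , v) ∈ₗ es) ⊎ ((v , u) ∈ₗ es)

P3Adj : Fin 3 → Fin 3 → Set
P3Adj zero (suc zero) = ⊤
P3Adj (suc zero) zero = ⊤
P3Adj (suc zero) (suc (suc zero)) = ⊤
P3Adj (suc (suc zero)) (suc zero) = ⊤
P3Adj _ _ = ⊥

Complement : ∀ {k} → (Fin k → Fin k → Set) → Fin k → Fin k → Set
Complement H i j = (i ≢ j) × ¬ H i j

coP3Adj : Fin 3 → Fin 3 → Set
coP3Adj = Complement P3Adj

IsInducedCopy : ∀ {n k} → List (Edge n) → (Fin k → Fin k → Set)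
              → (Fin k → Fin n) → Set
IsInducedCopy es H f =
  Injective _≡_ _≡_ f × (∀ i j → Adj es (f i) (f j) ⇔ H i j)

IsImage : ∀ {n k} → (Fin k → Fin n) → Subset n → Set
IsImage {n} {k} f S = ∀ (v : Fin n) → (v ∈ S) ⇔ Σ (Fin k) (λ i → f i ≡ v)

IndSubCorrect : ∀ {n k} → (Fin k → Fin k → Set) → List (Edge n)
              → Maybe (Subset n) → Set
IndSubCorrect {n} {k} H es nothing = ¬ Σ (Fin k → Fin n) (IsInducedCopy es H)
IndSubCorrect {n} {k} H es (just S) =
  Σ (Fin k → Fin n) (λ f → IsInducedCopy es H f × IsImage f S)

-- Deterministic multi-pass streaming algorithms with s bits of memory
-- (non-uniform, unbounded per-step computation, as usual in this model).
-- The update function may depend on the index of the current pass.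

record StreamAlg (n s : ℕ) : Set where
  field
    init   : Vec Bool s
    step   : ℕ → Vec Bool s → Edge n → Vec Bool s
    output : Vec Bool s → Maybe (Subset n)

open StreamAlg public

runFrom : ∀ {n s} → StreamAlg n s → List (Edge n) → ℕ → ℕ → Vec Bool s → Vec Bool s
runFrom A es i zero st = st
runFrom A es i (suc m) st = runFrom A es (suc i) m (foldl (step A i) st es)

runAlg : ∀ {n s} → StreamAlg n s → ℕ → List (Edge n) → Maybe (Subset n)
runAlg A p es = output A (runFrom A es 0 p (init A))

Solves : ∀ {n s k} → (Fin k → Fin k → Set) → StreamAlg n s → ℕ → Set
Solves {n} H A p = ∀ (es : List (Edge n)) → ValidStream es → IndSubCorrect H es (runAlg A p es)

-- A graph has no induced co-P₃ iff non-adjacency is transitive, i.e. iff it is complete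
-- multipartite. Label each vertex v by the index M v of its least non-neighbour (v itself
-- is one). If an edge ab has M a = M b, the vertex with index M a is a non-neighbour of
-- both and completes an induced co-P₃. If v ≁ w with M v < M w, the vertex with index M v
-- is adjacent to w (w is adjacent to everything below M w) but not to v: again a copy.
-- If neither happens, the label classes are the parts of a complete multipartite graph.
-- All labels are found together by a binary search over R = ⌈log₂ n⌉ passes, pass j
-- counting for every v its neighbours in a window of width 2^(R-j-1). Three more counting
-- passes give the degrees (deg v + |class of v| < n exposes a non-edge across classes),
-- the neighbours with the same label, and the neighbours of a single target vertex.
-- The state is one row of n counters of R + 1 bits per pass: R + 3 passes and
-- (R + 3) · n · (R + 1) = O(n log² n) bits.

module Submission where

open import Defs
open import Data.Nat
  using (ℕ; zero; suc; ⌊_/2⌋; ⌈_/2⌉; _+_; _*_; _^_; _∸_; _⊓_; _≤_; _<_; _<ᵇ_; z≤n; s≤s; _≟_; _<?_; _≤?_)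
open import Data.Nat using (_≤′_; ≤′-refl; ≤′-step)
open import Data.Nat.Properties
open import Data.Nat.Logarithm using (⌈log₂_⌉; ⌈log₂⌉-mono-≤)
open import Data.Nat.Logarithm.Core using (⌈log2⌉)
open import Data.Nat.Solver using (module +-*-Solver)
open +-*-Solver using (solve; _:+_; _:*_; _:^_; _:=_; con)
open import Induction.WellFounded using (Acc; acc)
open import Data.Bool using (Bool; true; false; if_then_else_)
open import Data.Fin using (Fin; zero; suc; toℕ; fromℕ<; combine; remQuot) renaming (_≟_ to _≟ᶠ_)
open import Data.Fin.Subset using (Subset)
open import Data.Fin.Properties using (any?; toℕ-injective; toℕ<n; 2↔Bool; combine-remQuot; toℕ-fromℕ<)
open import Data.List using (List; []; _∷_; foldl; map)
open import Data.Nat.ListAction using (sum)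
open import Data.List.Relation.Unary.Any using (here; there)
import Data.List.Relation.Unary.Any as Any
import Data.List.Relation.Unary.All as All
open import Data.List.Relation.Unary.AllPairs using (AllPairs; []; _∷_)
open import Data.Vec as Vec using (Vec; []; _∷_; lookup; tabulate; replicate)
open import Data.Vec.Relation.Unary.All as VecAll using ([]; _∷_)
open import Data.Vec.Relation.Unary.All.Properties using (tabulate⁺)
open import Data.Maybe using (Maybe; just; nothing)
import Data.Maybe.Properties as MaybeProp
open MaybeProp using (just-injective)
open import Data.Vec.Properties
  using (++-injective; []=⇒lookup; lookup⇒[]=; lookup∘tabulate; tabulate∘lookup; tabulate-cong; lookup-replicate)
open import Data.Product using (Σ; ∃; _×_; _,_; proj₁; proj₂)
import Data.Product.Properties as Product
open import Data.Sum using (_⊎_; inj₁; inj₂)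
import Data.Sum as Sum
open import Data.Empty using (⊥)
open import Data.Unit using (⊤; tt)
open import Function using (id; _∘_; case_of_; _⇔_; mk⇔; Equivalence; Inverse)
open import Relation.Nullary using (¬_; Dec; yes; no; does; contradiction)
open import Relation.Nullary.Decidable using (_×-dec_; _⊎-dec_; ¬?; dec-true; dec-false; decidable-stable)
open import Relation.Unary using (Decidable)
open import Relation.Binary using (DecidableEquality)
open import Relation.Binary.PropositionalEquality
open import Algebra.Properties.CommutativeSemigroup +-commutativeSemigroup using (interchange)

-- Counting decidable predicates on Fin n

indicator : ∀ {A : Set} → Dec A → ℕ
indicator a? = if does a? then 1 else 0

count : ∀ {n} {P : Fin n → Set} → Decidable P → ℕ
count {zero}  P? = 0
count {suc n} P? = indicator (P? zero) + count (P? ∘ suc)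

module _ {A B : Set} where

  indicator-mono : (a? : Dec A) (b? : Dec B) → (A → B) → indicator a? ≤ indicator b?
  indicator-mono (yes a) (yes _) _   = ≤-refl
  indicator-mono (yes a) (no ¬b) a→b = contradiction (a→b a) ¬b
  indicator-mono (no _)  _       _   = z≤n

  indicator-strict : (a? : Dec A) (b? : Dec B) → B → ¬ A → indicator a? < indicator b?
  indicator-strict (yes a) _       _ ¬a = contradiction a ¬a
  indicator-strict (no _)  (yes _) _ _  = s≤s z≤n
  indicator-strict (no _)  (no ¬b) b _  = contradiction b ¬b

  indicator-⊎ : (a? : Dec A) (b? : Dec B) → (A → B → ⊥) →
                indicator (a? ⊎-dec b?) ≡ indicator a? + indicator b?
  indicator-⊎ (yes a) (yes b) disjoint = contradiction b (disjoint a)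
  indicator-⊎ (yes _) (no _)  _        = refl
  indicator-⊎ (no _)  (yes _) _        = refl
  indicator-⊎ (no _)  (no _)  _        = refl

count-mono : ∀ {n} {P Q : Fin n → Set} (P? : Decidable P) (Q? : Decidable Q) →
             (∀ i → P i → Q i) → count P? ≤ count Q?
count-mono {zero}  _  _  _   = z≤n
count-mono {suc n} P? Q? P⊆Q =
  +-mono-≤ (indicator-mono (P? zero) (Q? zero) (P⊆Q zero)) (count-mono (P? ∘ suc) (Q? ∘ suc) (P⊆Q ∘ suc))

count-strict : ∀ {n} {P Q : Fin n → Set} (P? : Decidable P) (Q? : Decidable Q) →
               (∀ i → P i → Q i) → ∀ i → Q i → ¬ P i → count P? < count Q?
count-strict P? Q? P⊆Q zero q ¬p =
  +-mono-<-≤ (indicator-strict (P? zero) (Q? zero) q ¬p) (count-mono (P? ∘ suc) (Q? ∘ suc) (P⊆Q ∘ suc))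
count-strict P? Q? P⊆Q (suc i) q ¬p =
  +-mono-≤-< (indicator-mono (P? zero) (Q? zero) (P⊆Q zero))
             (count-strict (P? ∘ suc) (Q? ∘ suc) (P⊆Q ∘ suc) i q ¬p)

count-⇔ : ∀ {n} {P Q : Fin n → Set} (P? : Decidable P) (Q? : Decidable Q) →
          (∀ i → P i ⇔ Q i) → count P? ≡ count Q?
count-⇔ P? Q? P⇔Q =
  ≤-antisym (count-mono P? Q? (Equivalence.to ∘ P⇔Q)) (count-mono Q? P? (Equivalence.from ∘ P⇔Q))

count-≡ : ∀ {n} {P Q : Fin n → Set} (P? : Decidable P) (Q? : Decidable Q) →
          (∀ i → P i ≡ Q i) → count P? ≡ count Q?
count-≡ P? Q? P≡Q = count-⇔ P? Q? (λ i → mk⇔ (subst id (P≡Q i)) (subst id (sym (P≡Q i))))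

count-⊎ : ∀ {n} {P Q : Fin n → Set} (P? : Decidable P) (Q? : Decidable Q) →
          (∀ i → P i → Q i → ⊥) → count (λ i → P? i ⊎-dec Q? i) ≡ count P? + count Q?
count-⊎ {zero}  _  _  _        = refl
count-⊎ {suc n} P? Q? disjoint = begin
  indicator (P? zero ⊎-dec Q? zero) + count (λ i → P? (suc i) ⊎-dec Q? (suc i))
    ≡⟨ cong₂ _+_ (indicator-⊎ (P? zero) (Q? zero) (disjoint zero))
                 (count-⊎ (P? ∘ suc) (Q? ∘ suc) (disjoint ∘ suc)) ⟩
  (indicator (P? zero) + indicator (Q? zero)) + (count (P? ∘ suc) + count (Q? ∘ suc))
    ≡⟨ interchange (indicator (P? zero)) _ _ _ ⟩
  count P? + count Q? ∎
  where open ≡-Reasoning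

count-none : ∀ {n} {P : Fin n → Set} (P? : Decidable P) → (∀ i → ¬ P i) → count P? ≡ 0
count-none {zero}  _  _  = refl
count-none {suc n} P? ¬P =
  cong₂ _+_ (cong (λ b → if b then 1 else 0) (dec-false (P? zero) (¬P zero)))
            (count-none (P? ∘ suc) (¬P ∘ suc))

count-all : ∀ {n} {P : Fin n → Set} (P? : Decidable P) → (∀ i → P i) → count P? ≡ n
count-all {zero}  _  _ = refl
count-all {suc n} P? P =
  cong₂ _+_ (cong (λ b → if b then 1 else 0) (dec-true (P? zero) (P zero)))
            (count-all (P? ∘ suc) (P ∘ suc))

count≤n : ∀ {n} {P : Fin n → Set} (P? : Decidable P) → count P? ≤ n
count≤n P? = ≤-trans (count-mono P? (λ _ → yes tt) (λ _ _ → tt)) (≤-reflexive (count-all _ (λ _ → tt)))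

count-pos⇒∃ : ∀ {n} {P : Fin n → Set} (P? : Decidable P) → 0 < count P? → ∃ P
count-pos⇒∃ P? pos with any? P?
... | yes witness = witness
... | no  none    = contradiction (count-none P? (λ i p → none (i , p))) (≢-sym (<⇒≢ pos))

∃⇒count-pos : ∀ {n} {P : Fin n → Set} (P? : Decidable P) → ∀ i → P i → 0 < count P?
∃⇒count-pos {n} P? i p =
  subst (_< count P?) (count-none ∅? (λ _ ())) (count-strict ∅? P? (λ _ ()) i p (λ ()))
  where
  ∅? : Decidable {A = Fin n} (λ _ → ⊥)
  ∅? _ = no (λ ())

count-<⇒∃ : ∀ {n} {P Q : Fin n → Set} (P? : Decidable P) (Q? : Decidable Q) →
            (∀ i → P i → Q i) → count P? < count Q? → ∃ λ i → Q i × ¬ P i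
count-<⇒∃ {P = P} {Q} P? Q? _ lt with any? (λ i → Q? i ×-dec ¬? (P? i))
... | yes witness = witness
... | no  none    = contradiction (count-mono Q? P? Q⊆P) (<⇒≱ lt)
  where
  Q⊆P : ∀ i → Q i → P i
  Q⊆P i q = decidable-stable (P? i) (λ ¬p → none (i , q , ¬p))

count-≥⇒⊇ : ∀ {n} {P Q : Fin n → Set} (P? : Decidable P) (Q? : Decidable Q) →
            (∀ i → P i → Q i) → count Q? ≤ count P? → ∀ i → Q i → P i
count-≥⇒⊇ P? Q? P⊆Q ge i q =
  decidable-stable (P? i) (λ ¬p → <⇒≱ (count-strict P? Q? P⊆Q i q ¬p) ge)

count≡n⇒all : ∀ {n} {P : Fin n → Set} (P? : Decidable P) → count P? ≡ n → ∀ i → P i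
count≡n⇒all P? full i =
  count-≥⇒⊇ P? (λ _ → yes tt) (λ _ _ → tt)
            (≤-reflexive (trans (count-all _ (λ _ → tt)) (sym full))) i tt

-- Edge streams and a single counting pass

_≟ₑ_ : ∀ {n} → DecidableEquality (Edge n)
_≟ₑ_ = Product.≡-dec _≟ᶠ_ _≟ᶠ_

Adj? : ∀ {n} (es : List (Edge n)) v u → Dec (Adj es v u)
Adj? es v u = Any.any? ((v , u) ≟ₑ_) es ⊎-dec Any.any? ((u , v) ≟ₑ_) es

Adj-sym : ∀ {n} {es : List (Edge n)} {v u} → Adj es v u → Adj es u v
Adj-sym = Sum.swap

Adj-irrefl : ∀ {n} {es : List (Edge n)} → All.All (λ e → proj₁ e ≢ proj₂ e) es →
             ∀ v → ¬ Adj es v v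
Adj-irrefl noLoops v (inj₁ v,v∈es) = All.lookup noLoops v,v∈es refl
Adj-irrefl noLoops v (inj₂ v,v∈es) = All.lookup noLoops v,v∈es refl

Touches : ∀ {n} → Edge n → Fin n → Fin n → Set
Touches e v u = (v , u) ≡ e ⊎ (u , v) ≡ e

Touches? : ∀ {n} (e : Edge n) v u → Dec (Touches e v u)
Touches? e v u = ((v , u) ≟ₑ e) ⊎-dec ((u , v) ≟ₑ e)

Adj-∷ : ∀ {n} {e : Edge n} {es v u} → Adj (e ∷ es) v u ⇔ (Touches e v u ⊎ Adj es v u)
Adj-∷ {e = e} {es} {v} {u} = mk⇔ to from
  where
  to : Adj (e ∷ es) v u → Touches e v u ⊎ Adj es v u
  to (inj₁ (here p))  = inj₁ (inj₁ p)
  to (inj₁ (there m)) = inj₂ (inj₁ m)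
  to (inj₂ (here p))  = inj₁ (inj₂ p)
  to (inj₂ (there m)) = inj₂ (inj₂ m)
  from : Touches e v u ⊎ Adj es v u → Adj (e ∷ es) v u
  from (inj₁ (inj₁ p)) = inj₁ (here p)
  from (inj₁ (inj₂ p)) = inj₂ (here p)
  from (inj₂ (inj₁ m)) = inj₁ (there m)
  from (inj₂ (inj₂ m)) = inj₂ (there m)

Touches⇒SameEdge : ∀ {n} {e : Edge n} {v u} → Touches e v u → SameEdge e (v , u)
Touches⇒SameEdge (inj₁ refl) = inj₁ (refl , refl)
Touches⇒SameEdge (inj₂ refl) = inj₂ (refl , refl)

Touches-fresh : ∀ {n} {e : Edge n} {es v u} → All.All (λ e′ → ¬ SameEdge e e′) es →
                Touches e v u → ¬ Adj es v u
Touches-fresh fresh t (inj₁ m) = All.lookup fresh m (Touches⇒SameEdge t)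
Touches-fresh fresh t (inj₂ m) = All.lookup fresh m (Touches⇒SameEdge (Sum.swap t))

Row : ℕ → Set
Row n = Vec ℕ n

zeros : ∀ {n} → Row n
zeros = replicate _ 0

neighbourCounts : ∀ {n} {Q : Fin n → Fin n → Set} → List (Edge n) → (∀ v u → Dec (Q v u)) → Row n
neighbourCounts es Q? = tabulate λ v → count (λ u → Adj? es v u ×-dec Q? v u)

edgeCount : ∀ {n} {Q : Fin n → Fin n → Set} → (∀ v u → Dec (Q v u)) → Edge n → Fin n → ℕ
edgeCount Q? e v = count (λ u → Touches? e v u ×-dec Q? v u)

sum-edgeCount : ∀ {n} {Q : Fin n → Fin n → Set} (Q? : ∀ v u → Dec (Q v u)) {es} →
                AllPairs (λ e e′ → ¬ SameEdge e e′) es →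
                ∀ v → sum (map (λ e → edgeCount Q? e v) es) ≡ count (λ u → Adj? es v u ×-dec Q? v u)
sum-edgeCount Q? [] v =
  sym (count-none (λ u → Adj? [] v u ×-dec Q? v u) λ { _ (inj₁ () , _) ; _ (inj₂ () , _) })
sum-edgeCount {Q = Q} Q? {e ∷ es} (fresh ∷ rest) v = begin
  edgeCount Q? e v + sum (map (λ e → edgeCount Q? e v) es)
    ≡⟨ cong (edgeCount Q? e v +_) (sum-edgeCount Q? rest v) ⟩
  count new? + count old?
    ≡⟨ count-⊎ new? old? (λ u (t , _) (adj , _) → Touches-fresh fresh t adj) ⟨
  count (λ u → new? u ⊎-dec old? u)
    ≡⟨ count-⇔ (λ u → new? u ⊎-dec old? u) (λ u → Adj? (e ∷ es) v u ×-dec Q? v u)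
               (λ u → mk⇔ to from) ⟩
  count (λ u → Adj? (e ∷ es) v u ×-dec Q? v u) ∎
  where
  open ≡-Reasoning
  new? : ∀ u → Dec (Touches e v u × Q v u)
  new? u = Touches? e v u ×-dec Q? v u
  old? : ∀ u → Dec (Adj es v u × Q v u)
  old? u = Adj? es v u ×-dec Q? v u
  to : ∀ {u} → (Touches e v u × Q v u) ⊎ (Adj es v u × Q v u) → Adj (e ∷ es) v u × Q v u
  to (inj₁ (t , q))   = Equivalence.from Adj-∷ (inj₁ t) , q
  to (inj₂ (adj , q)) = Equivalence.from Adj-∷ (inj₂ adj) , q
  from : ∀ {u} → Adj (e ∷ es) v u × Q v u → (Touches e v u × Q v u) ⊎ (Adj es v u × Q v u)
  from (adj , q) = Sum.map (_, q) (_, q) (Equivalence.to Adj-∷ adj)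

⊓-absorbs-+ : ∀ x k c → (x ⊓ c + k) ⊓ c ≡ (x + k) ⊓ c
⊓-absorbs-+ x k c = begin
  (x ⊓ c + k) ⊓ c           ≡⟨ cong (_⊓ c) (+-distribʳ-⊓ k x c) ⟩
  (x + k) ⊓ (c + k) ⊓ c     ≡⟨ ⊓-assoc (x + k) (c + k) c ⟩
  (x + k) ⊓ ((c + k) ⊓ c)   ≡⟨ cong ((x + k) ⊓_) (m≥n⇒m⊓n≡n (m≤m+n c k)) ⟩
  (x + k) ⊓ c               ∎
  where open ≡-Reasoning

foldl-capped : ∀ {A : Set} c (f : A → ℕ) x xs →
               foldl (λ y a → (y + f a) ⊓ c) (x ⊓ c) xs ≡ (x + sum (map f xs)) ⊓ c
foldl-capped c f x []       = cong (_⊓ c) (sym (+-identityʳ x))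
foldl-capped {A} c f x (a ∷ xs) = begin
  foldl add ((x ⊓ c + f a) ⊓ c) xs  ≡⟨ cong (λ y → foldl add y xs) (⊓-absorbs-+ x (f a) c) ⟩
  foldl add ((x + f a) ⊓ c) xs      ≡⟨ foldl-capped c f (x + f a) xs ⟩
  (x + f a + sum (map f xs)) ⊓ c    ≡⟨ cong (_⊓ c) (+-assoc x (f a) _) ⟩
  (x + sum (map f (a ∷ xs))) ⊓ c    ∎
  where
  open ≡-Reasoning
  add : ℕ → A → ℕ
  add y a = (y + f a) ⊓ c

-- Counters saturate at n, so every reachable table is encodable whatever the stream;
-- on a valid stream the cap is never reached (count≤n).
passRow : ∀ {n} {Q : Fin n → Fin n → Set} → (∀ v u → Dec (Q v u)) → Row n → Edge n → Row n
passRow {n} Q? r e = tabulate λ v → (lookup r v + edgeCount Q? e v) ⊓ n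

lookup-foldl-passRow : ∀ {n} {Q : Fin n → Fin n → Set} (Q? : ∀ v u → Dec (Q v u)) r es v →
  lookup (foldl (passRow Q?) r es) v ≡ foldl (λ y e → (y + edgeCount Q? e v) ⊓ n) (lookup r v) es
lookup-foldl-passRow Q? r []       v = refl
lookup-foldl-passRow {n} Q? r (e ∷ es) v =
  trans (lookup-foldl-passRow Q? (passRow Q? r e) es v)
        (cong (λ y → foldl (λ y e → (y + edgeCount Q? e v) ⊓ n) y es) (lookup∘tabulate _ v))

foldl-passRow : ∀ {n} {Q : Fin n → Fin n → Set} (Q? : ∀ v u → Dec (Q v u)) {es} →
                AllPairs (λ e e′ → ¬ SameEdge e e′) es →
                foldl (passRow Q?) zeros es ≡ neighbourCounts es Q?
foldl-passRow {n} Q? {es} fresh =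
  trans (sym (tabulate∘lookup _)) (tabulate-cong λ v → begin
    lookup (foldl (passRow Q?) zeros es) v
      ≡⟨ lookup-foldl-passRow Q? _ es v ⟩
    foldl (λ y e → (y + edgeCount Q? e v) ⊓ n) (lookup zeros v) es
      ≡⟨ cong (λ y → foldl (λ y e → (y + edgeCount Q? e v) ⊓ n) y es) (lookup-replicate v 0) ⟩
    foldl (λ y e → (y + edgeCount Q? e v) ⊓ n) (0 ⊓ n) es
      ≡⟨ foldl-capped n (λ e → edgeCount Q? e v) 0 es ⟩
    sum (map (λ e → edgeCount Q? e v) es) ⊓ n
      ≡⟨ cong (_⊓ n) (sum-edgeCount Q? fresh v) ⟩
    count (λ u → Adj? es v u ×-dec Q? v u) ⊓ n
      ≡⟨ m≤n⇒m⊓n≡m (count≤n _) ⟩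
    count (λ u → Adj? es v u ×-dec Q? v u) ∎)
  where open ≡-Reasoning

-- Simulating a machine with an arbitrary state type by bits

record Code (A : Set) (s : ℕ) : Set₁ where
  field
    Valid         : A → Set
    encode        : A → Vec Bool s
    decode        : Vec Bool s → A
    decode-encode : ∀ {x} → Valid x → decode (encode x) ≡ x

toBits : ∀ B → Fin (2 ^ B) → Vec Bool B
toBits zero    _ = []
toBits (suc B) i = Inverse.to 2↔Bool (proj₁ q) ∷ toBits B (proj₂ q)
  where
  q : Fin 2 × Fin (2 ^ B)
  q = remQuot {2} (2 ^ B) i

fromBits : ∀ {B} → Vec Bool B → Fin (2 ^ B)
fromBits []       = zero
fromBits (b ∷ bs) = combine (Inverse.from 2↔Bool b) (fromBits bs)

fromBits-toBits : ∀ B i → fromBits (toBits B i) ≡ i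
fromBits-toBits zero    zero = refl
fromBits-toBits (suc B) i    =
  trans (cong₂ combine (Inverse.strictlyInverseʳ 2↔Bool (proj₁ q)) (fromBits-toBits B (proj₂ q)))
        (combine-remQuot {2} (2 ^ B) i)
  where
  q : Fin 2 × Fin (2 ^ B)
  q = remQuot {2} (2 ^ B) i

counterCode : ∀ {n B} → n < 2 ^ B → Code ℕ B
counterCode {n} {B} n<2^B = record
  { Valid         = _≤ n
  ; encode        = λ x → toBits B (fromℕ< (≤-<-trans (m⊓n≤n x n) n<2^B))
  ; decode        = toℕ ∘ fromBits
  ; decode-encode = λ x≤n →
      trans (cong toℕ (fromBits-toBits B _)) (trans (toℕ-fromℕ< _) (m≤n⇒m⊓n≡m x≤n))
  }

concat-injective : ∀ {A : Set} {k s} (xss yss : Vec (Vec A s) k) →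
                   Vec.concat xss ≡ Vec.concat yss → xss ≡ yss
concat-injective []         []         _  = refl
concat-injective (xs ∷ xss) (ys ∷ yss) eq =
  cong₂ _∷_ (proj₁ (++-injective xs ys eq)) (concat-injective xss yss (proj₂ (++-injective xs ys eq)))

vecCode : ∀ {A s} → Code A s → ∀ k → Code (Vec A k) (k * s)
vecCode {A} {s} C k = record
  { Valid         = VecAll.All Valid
  ; encode        = Vec.concat ∘ Vec.map encode
  ; decode        = λ bs → Vec.map decode (proj₁ (Vec.group k s bs))
  ; decode-encode = λ {xs} valid → trans (cong (Vec.map decode) (ungroup-concat xs)) (map-decode-encode valid)
  }
  where
  open Code C
  ungroup-concat : ∀ xs → proj₁ (Vec.group k s (Vec.concat (Vec.map encode xs))) ≡ Vec.map encode xs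
  ungroup-concat xs = sym (concat-injective _ _ (proj₂ (Vec.group k s (Vec.concat (Vec.map encode xs)))))
  map-decode-encode : ∀ {j} {xs : Vec A j} → VecAll.All Valid xs → Vec.map decode (Vec.map encode xs) ≡ xs
  map-decode-encode []             = refl
  map-decode-encode (valid ∷ rest) = cong₂ _∷_ (decode-encode valid) (map-decode-encode rest)

record Machine (n : ℕ) (X : Set) : Set where
  field
    start  : X
    update : ℕ → X → Edge n → X
    finish : X → Maybe (Subset n)

runPasses : ∀ {n X} → Machine n X → List (Edge n) → ℕ → ℕ → X → X
runPasses M es i zero    x = x
runPasses M es i (suc p) x = runPasses M es (suc i) p (foldl (Machine.update M i) x es)

implement : ∀ {n X s} → Machine n X → Code X s → StreamAlg n s
implement M C = record
  { init   = encode start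
  ; step   = λ i bs e → encode (update i (decode bs) e)
  ; output = finish ∘ decode
  }
  where
  open Machine M
  open Code C

module _ {n : ℕ} {X : Set} {s : ℕ} (M : Machine n X) (C : Code X s) where
  open Machine M
  open Code C

  runAlg-implement : Valid start → (∀ i x e → Valid x → Valid (update i x e)) →
                     ∀ p es → runAlg (implement M C) p es ≡ finish (runPasses M es 0 p start)
  runAlg-implement valid-start valid-update p es =
    trans (cong (finish ∘ decode) (runFrom-implement 0 p valid-start))
          (cong finish (decode-encode (runPasses-valid 0 p valid-start)))
    where
    foldl-valid : ∀ i {x} es → Valid x → Valid (foldl (update i) x es)
    foldl-valid i []       valid = valid
    foldl-valid i (e ∷ es) valid = foldl-valid i es (valid-update i _ e valid)
    foldl-implement : ∀ i {x} es → Valid x →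
                      foldl (step (implement M C) i) (encode x) es ≡ encode (foldl (update i) x es)
    foldl-implement i []       valid = refl
    foldl-implement i (e ∷ es) valid = trans
      (cong (λ y → foldl (step (implement M C) i) (encode (update i y e)) es) (decode-encode valid))
      (foldl-implement i es (valid-update i _ e valid))
    runPasses-valid : ∀ i p {x} → Valid x → Valid (runPasses M es i p x)
    runPasses-valid i zero    valid = valid
    runPasses-valid i (suc p) valid = runPasses-valid (suc i) p (foldl-valid i es valid)
    runFrom-implement : ∀ i p {x} → Valid x →
                        runFrom (implement M C) es i p (encode x) ≡ encode (runPasses M es i p x)
    runFrom-implement i zero    valid = refl
    runFrom-implement i (suc p) valid = trans
      (cong (runFrom (implement M C) es (suc i) p) (foldl-implement i es valid))
      (runFrom-implement (suc i) p (foldl-valid i es valid))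

-- Multi-pass counting tables

Table : ℕ → ℕ → Set
Table n m = Vec (Row n) m

emptyTable : ∀ {n m} → Table n m
emptyTable = replicate _ zeros

row : ∀ {n m} → ℕ → Table n m → Row n
row _       []      = zeros
row zero    (r ∷ T) = r
row (suc k) (_ ∷ T) = row k T

setRow : ∀ {n m} → ℕ → Row n → Table n m → Table n m
setRow _       _ []      = []
setRow zero    r (_ ∷ T) = r ∷ T
setRow (suc k) r (x ∷ T) = x ∷ setRow k r T

keepRows : ∀ {n m} → ℕ → Table n m → Table n m
keepRows zero    _       = emptyTable
keepRows (suc j) []      = []
keepRows (suc j) (r ∷ T) = r ∷ keepRows j T

table-ext : ∀ {n m} (T T′ : Table n m) → (∀ k → row k T ≡ row k T′) → T ≡ T′
table-ext []      []        _    = refl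
table-ext (r ∷ T) (r′ ∷ T′) rows = cong₂ _∷_ (rows zero) (table-ext T T′ (rows ∘ suc))

row-emptyTable : ∀ {n m} k → row k (emptyTable {n} {m}) ≡ zeros
row-emptyTable {m = zero}  _       = refl
row-emptyTable {m = suc m} zero    = refl
row-emptyTable {m = suc m} (suc k) = row-emptyTable {m = m} k

row-setRow-same : ∀ {n m} k r (T : Table n m) → k < m → row k (setRow k r T) ≡ r
row-setRow-same zero    r (_ ∷ T) _         = refl
row-setRow-same (suc k) r (_ ∷ T) (s≤s k<m) = row-setRow-same k r T k<m

row-setRow-other : ∀ {n m} k j r (T : Table n m) → k ≢ j → row k (setRow j r T) ≡ row k T
row-setRow-other k       j       r []      _   = refl
row-setRow-other zero    zero    r (_ ∷ T) k≢j = contradiction refl k≢j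
row-setRow-other zero    (suc j) r (_ ∷ T) _   = refl
row-setRow-other (suc k) zero    r (_ ∷ T) _   = refl
row-setRow-other (suc k) (suc j) r (_ ∷ T) k≢j = row-setRow-other k j r T (k≢j ∘ cong suc)

row-keepRows-< : ∀ {n m} k j (T : Table n m) → k < j → row k (keepRows j T) ≡ row k T
row-keepRows-< k       (suc j) []      _         = refl
row-keepRows-< zero    (suc j) (_ ∷ T) _         = refl
row-keepRows-< (suc k) (suc j) (_ ∷ T) (s≤s k<j) = row-keepRows-< k j T k<j

row-keepRows-≥ : ∀ {n m} k j (T : Table n m) → j ≤ k → row k (keepRows j T) ≡ zeros
row-keepRows-≥ {m = m} k zero T _ = row-emptyTable {m = m} k
row-keepRows-≥ k       (suc j) []      _         = refl
row-keepRows-≥ (suc k) (suc j) (_ ∷ T) (s≤s j≤k) = row-keepRows-≥ k j T j≤k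

setRow-setRow : ∀ {n m} j r r′ (T : Table n m) → setRow j r′ (setRow j r T) ≡ setRow j r′ T
setRow-setRow j       r r′ []      = refl
setRow-setRow zero    r r′ (_ ∷ T) = refl
setRow-setRow (suc j) r r′ (x ∷ T) = cong (x ∷_) (setRow-setRow j r r′ T)

setRow-row : ∀ {n m} j (T : Table n m) → setRow j (row j T) T ≡ T
setRow-row j       []      = refl
setRow-row zero    (_ ∷ T) = refl
setRow-row (suc j) (x ∷ T) = cong (x ∷_) (setRow-row j T)

All-setRow : ∀ {n m} {P : Row n → Set} j {r} {T : Table n m} →
             P r → VecAll.All P T → VecAll.All P (setRow j r T)
All-setRow j       _  []        = []
All-setRow zero    pr (_ ∷ pT)  = pr ∷ pT
All-setRow (suc j) pr (px ∷ pT) = px ∷ All-setRow j pr pT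

All-replicate : ∀ {A : Set} {P : A → Set} k {x} → P x → VecAll.All P (replicate k x)
All-replicate zero    _  = []
All-replicate (suc k) px = px ∷ All-replicate k px

module CountingPasses {n m : ℕ} {Q : ℕ → Table n m → Fin n → Fin n → Set}
                      (Q? : ∀ j T v u → Dec (Q j T v u)) where

  -- Pass j queries only the rows of earlier passes, never the row it is filling.
  passStep : ℕ → Table n m → Edge n → Table n m
  passStep j T e = setRow j (passRow (Q? j (keepRows j T)) (row j T) e) T

  machine : (Table n m → Maybe (Subset n)) → Machine n (Table n m)
  machine out = record { start = emptyTable ; update = passStep ; finish = out }

  tableCode : ∀ {B} → n < 2 ^ B → Code (Table n m) (m * (n * B))
  tableCode n<2^B = vecCode (vecCode (counterCode n<2^B) n) m

  algorithm : ∀ {B} → n < 2 ^ B → (Table n m → Maybe (Subset n)) → StreamAlg n (m * (n * B))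
  algorithm n<2^B out = implement (machine out) (tableCode n<2^B)

  passStep-valid : ∀ j T e → VecAll.All (VecAll.All (_≤ n)) T →
                   VecAll.All (VecAll.All (_≤ n)) (passStep j T e)
  passStep-valid j T e = All-setRow j (tabulate⁺ (λ v → m⊓n≤n _ n))

  module _ (es : List (Edge n)) where

    afterPasses : ℕ → Table n m
    afterPasses zero    = emptyTable
    afterPasses (suc j) = setRow j (neighbourCounts es (Q? j (afterPasses j))) (afterPasses j)

    row-afterPasses-fresh : ∀ {j k} → j ≤ k → row k (afterPasses j) ≡ zeros
    row-afterPasses-fresh {zero}  {k} _   = row-emptyTable {m = m} k
    row-afterPasses-fresh {suc j} {k} j<k =
      trans (row-setRow-other k j _ (afterPasses j) (≢-sym (<⇒≢ j<k))) (row-afterPasses-fresh (<⇒≤ j<k))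

    row-afterPasses-stable : ∀ {i j k} → i < j → j ≤′ k → row i (afterPasses k) ≡ row i (afterPasses j)
    row-afterPasses-stable i<j ≤′-refl              = refl
    row-afterPasses-stable i<j (≤′-step {k} j≤′k) =
      trans (row-setRow-other _ k _ (afterPasses k) (<⇒≢ (<-≤-trans i<j (≤′⇒≤ j≤′k))))
            (row-afterPasses-stable i<j j≤′k)

    row-afterPasses : ∀ {k j} → k < j → k < m →
                      row k (afterPasses j) ≡ neighbourCounts es (Q? k (afterPasses k))
    row-afterPasses {k} k<j k<m =
      trans (row-afterPasses-stable (n<1+n k) (≤⇒≤′ k<j)) (row-setRow-same k _ (afterPasses k) k<m)

    keepRows-afterPasses : ∀ {j k} → j ≤ k → keepRows j (afterPasses k) ≡ afterPasses j
    keepRows-afterPasses {j} {k} j≤k = table-ext _ _ λ i → case i <? j of λ where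
      (yes i<j) → trans (row-keepRows-< i j (afterPasses k) i<j)
                        (row-afterPasses-stable i<j (≤⇒≤′ j≤k))
      (no i≮j)  → trans (row-keepRows-≥ i j (afterPasses k) (≮⇒≥ i≮j))
                        (sym (row-afterPasses-fresh (≮⇒≥ i≮j)))

    keepRows-setRow-afterPasses : ∀ j r → keepRows j (setRow j r (afterPasses j)) ≡ afterPasses j
    keepRows-setRow-afterPasses j r = table-ext _ _ λ i → case i <? j of λ where
      (yes i<j) → trans (row-keepRows-< i j (setRow j r (afterPasses j)) i<j)
                        (row-setRow-other i j r (afterPasses j) (<⇒≢ i<j))
      (no i≮j)  → trans (row-keepRows-≥ i j (setRow j r (afterPasses j)) (≮⇒≥ i≮j))
                        (sym (row-afterPasses-fresh (≮⇒≥ i≮j)))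

    foldl-passStep : ∀ {j} → j < m → ∀ r es′ →
      foldl (passStep j) (setRow j r (afterPasses j)) es′ ≡
      setRow j (foldl (passRow (Q? j (afterPasses j))) r es′) (afterPasses j)
    foldl-passStep j<m r []        = refl
    foldl-passStep {j} j<m r (e ∷ es′) =
      trans (cong (λ T → foldl (passStep j) T es′) one-step) (foldl-passStep j<m _ es′)
      where
      one-step : passStep j (setRow j r (afterPasses j)) e ≡
                 setRow j (passRow (Q? j (afterPasses j)) r e) (afterPasses j)
      one-step rewrite keepRows-setRow-afterPasses j r | row-setRow-same j r (afterPasses j) j<m =
        setRow-setRow j r _ (afterPasses j)

    pass : ∀ {j} → j < m → ValidStream es → foldl (passStep j) (afterPasses j) es ≡ afterPasses (suc j)
    pass {j} j<m (_ , fresh) = begin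
      foldl (passStep j) (afterPasses j) es
        ≡⟨ cong (λ T → foldl (passStep j) T es) (setRow-row j (afterPasses j)) ⟨
      foldl (passStep j) (setRow j (row j (afterPasses j)) (afterPasses j)) es
        ≡⟨ cong (λ r → foldl (passStep j) (setRow j r (afterPasses j)) es)
                (row-afterPasses-fresh {j} ≤-refl) ⟩
      foldl (passStep j) (setRow j zeros (afterPasses j)) es
        ≡⟨ foldl-passStep j<m zeros es ⟩
      setRow j (foldl (passRow (Q? j (afterPasses j))) zeros es) (afterPasses j)
        ≡⟨ cong (λ r → setRow j r (afterPasses j)) (foldl-passRow _ fresh) ⟩
      afterPasses (suc j) ∎
      where open ≡-Reasoning

    runPasses-machine : ∀ out → ValidStream es → ∀ p j → p + j ≤ m →
                        runPasses (machine out) es j p (afterPasses j) ≡ afterPasses (p + j)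
    runPasses-machine out valid zero    j _     = refl
    runPasses-machine out valid (suc p) j p+j<m =
      trans (cong (runPasses (machine out) es (suc j) p) (pass (≤-trans (s≤s (m≤n+m j p)) p+j<m) valid))
            (trans (runPasses-machine out valid p (suc j) (subst (_≤ m) (sym (+-suc p j)) p+j<m))
                   (cong afterPasses (+-suc p j)))

  algorithm-result : ∀ {B} (n<2^B : n < 2 ^ B) out es → ValidStream es →
                     runAlg (algorithm n<2^B out) m es ≡ out (afterPasses es m)
  algorithm-result {B} n<2^B out es valid =
    trans (runAlg-implement (machine out) (tableCode {B} n<2^B)
                            (All-replicate m (All-replicate n z≤n)) passStep-valid m es)
          (cong out (trans (runPasses-machine es out valid m 0 (≤-reflexive (+-identityʳ m)))
                           (cong (afterPasses es) (+-identityʳ m))))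

-- Induced copies of co-P₃ and how to decide their existence

triple : ∀ {n} → Fin n → Fin n → Fin n → Fin 3 → Fin n
triple x z y zero             = x
triple x z y (suc zero)       = z
triple x z y (suc (suc zero)) = y

coP3-copy : ∀ {n} {es : List (Edge n)} → All.All (λ e → proj₁ e ≢ proj₂ e) es →
            ∀ {x z y} → Adj es x y → ¬ Adj es x z → ¬ Adj es z y → IsInducedCopy es coP3Adj (triple x z y)
coP3-copy {es = es} noLoops {x} {z} {y} x~y x≁z z≁y = injective , adjacency
  where
  x≢z : x ≢ z
  x≢z refl = z≁y x~y
  z≢y : z ≢ y
  z≢y refl = x≁z x~y
  x≢y : x ≢ y
  x≢y refl = Adj-irrefl noLoops x x~y
  injective : ∀ {i j} → triple x z y i ≡ triple x z y j → i ≡ j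
  injective {zero}             {zero}             _ = refl
  injective {zero}             {suc zero}         p = contradiction p x≢z
  injective {zero}             {suc (suc zero)}   p = contradiction p x≢y
  injective {suc zero}         {zero}             p = contradiction (sym p) x≢z
  injective {suc zero}         {suc zero}         _ = refl
  injective {suc zero}         {suc (suc zero)}   p = contradiction p z≢y
  injective {suc (suc zero)}   {zero}             p = contradiction (sym p) x≢y
  injective {suc (suc zero)}   {suc zero}         p = contradiction (sym p) z≢y
  injective {suc (suc zero)}   {suc (suc zero)}   _ = refl
  neither : ∀ {A B : Set} → ¬ A → ¬ B → A ⇔ B
  neither ¬a ¬b = mk⇔ (λ a → contradiction a ¬a) (λ b → contradiction b ¬b)
  both : ∀ {A B : Set} → A → B → A ⇔ B
  both a b = mk⇔ (λ _ → b) (λ _ → a)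
  loop : ∀ {i} → ¬ coP3Adj i i
  loop (i≢i , _) = i≢i refl
  path : ∀ {i j} → P3Adj i j → ¬ coP3Adj i j
  path p (_ , ¬p) = ¬p p
  irrefl : ∀ v → ¬ Adj es v v
  irrefl = Adj-irrefl noLoops
  adjacency : ∀ i j → Adj es (triple x z y i) (triple x z y j) ⇔ coP3Adj i j
  adjacency zero             zero             = neither (irrefl x) loop
  adjacency zero             (suc zero)       = neither x≁z (path tt)
  adjacency zero             (suc (suc zero)) = both x~y ((λ ()) , (λ ()))
  adjacency (suc zero)       zero             = neither (x≁z ∘ Adj-sym) (path tt)
  adjacency (suc zero)       (suc zero)       = neither (irrefl z) loop
  adjacency (suc zero)       (suc (suc zero)) = neither z≁y (path tt)
  adjacency (suc (suc zero)) zero             = both (Adj-sym x~y) ((λ ()) , (λ ()))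
  adjacency (suc (suc zero)) (suc zero)       = neither (z≁y ∘ Adj-sym) (path tt)
  adjacency (suc (suc zero)) (suc (suc zero)) = neither (irrefl y) loop

coP3-shape : ∀ {n} {es : List (Edge n)} {f} → IsInducedCopy es coP3Adj f →
             Adj es (f zero) (f (suc (suc zero))) ×
             ¬ Adj es (f zero) (f (suc zero)) ×
             ¬ Adj es (f (suc zero)) (f (suc (suc zero)))
coP3-shape (_ , adjacency) =
    Equivalence.from (adjacency zero (suc (suc zero))) ((λ ()) , (λ ()))
  , (λ a → proj₂ (Equivalence.to (adjacency zero (suc zero)) a) tt)
  , (λ a → proj₂ (Equivalence.to (adjacency (suc zero) (suc (suc zero))) a) tt)

image : ∀ {n k} → (Fin k → Fin n) → Subset n
image f = tabulate λ v → does (any? λ i → f i ≟ᶠ v)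

image-IsImage : ∀ {n k} (f : Fin k → Fin n) → IsImage f (image f)
image-IsImage f v = mk⇔
  (λ v∈ → does⇒ (any? λ i → f i ≟ᶠ v) (trans (sym (lookup∘tabulate _ v)) ([]=⇒lookup v∈)))
  (λ hit → lookup⇒[]= v (image f) (trans (lookup∘tabulate _ v) (dec-true (any? λ i → f i ≟ᶠ v) hit)))
  where
  does⇒ : ∀ {A : Set} (a? : Dec A) → does a? ≡ true → A
  does⇒ (yes a) _ = a

_≟ₘ_ : ∀ {n} → DecidableEquality (Maybe (Fin n))
_≟ₘ_ = MaybeProp.≡-dec _≟ᶠ_

LeastNonNeighbour : ∀ {n} → List (Edge n) → Fin n → Fin n → Set
LeastNonNeighbour es v r = ¬ Adj es v r × (∀ u → toℕ u < toℕ r → Adj es v u)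

classSize : ∀ {n} → (Fin n → ℕ) → Fin n → ℕ
classSize M v = count (λ u → M u ≟ M v)

data Diagnosis {n} (M : Fin n → ℕ) (deg int : Row n) : Set where
  edgeInClass   : (a : Fin n) → 0 < lookup int a → Diagnosis M deg int
  nonEdgeAcross : (∀ a → ¬ 0 < lookup int a) →
                  (v : Fin n) → lookup deg v + classSize M v ≢ n → Diagnosis M deg int
  multipartite  : (∀ a → ¬ 0 < lookup int a) →
                  (∀ v → lookup deg v + classSize M v ≡ n) → Diagnosis M deg int

diagnose : ∀ {n} (M : Fin n → ℕ) deg int → Diagnosis M deg int
diagnose {n} M deg int with any? (λ a → 0 <? lookup int a)
... | yes (a , pos) = edgeInClass a pos
... | no noEdge with any? (λ v → ¬? (lookup deg v + classSize M v ≟ n))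
...   | yes (v , gap) = nonEdgeAcross (λ a pos → noEdge (a , pos)) v gap
...   | no noGap      = multipartite (λ a pos → noEdge (a , pos))
                                     (λ v → decidable-stable (_ ≟ n) (λ gap → noGap (v , gap)))

target : ∀ {n} {M : Fin n → ℕ} {deg int} → Diagnosis M deg int → Maybe (Fin n)
target (edgeInClass a _)     = just a
target (nonEdgeAcross _ v _) = just v
target (multipartite _ _)    = nothing

withRepresentative : ∀ {n l} → Dec (∃ λ (r : Fin n) → toℕ r ≡ l) → (Fin n → Fin 3 → Fin n) →
                     Maybe (Subset n)
withRepresentative (yes (r , _)) f = just (image (f r))
withRepresentative (no _)        _ = nothing

withRepresentative-correct : ∀ {n} {es : List (Edge n)} {l r} (s : Dec (∃ λ (r : Fin n) → toℕ r ≡ l)) f →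
  toℕ r ≡ l → IsInducedCopy es coP3Adj (f r) → IndSubCorrect coP3Adj es (withRepresentative s f)
withRepresentative-correct {es = es} {r = r} (yes (r′ , r′≡l)) f r≡l copy =
    f r′
  , subst (IsInducedCopy es coP3Adj ∘ f) (toℕ-injective (trans r≡l (sym r′≡l))) copy
  , image-IsImage (f r′)
withRepresentative-correct {r = r} (no none) f r≡l copy = contradiction (r , r≡l) none

-- The searches are taken as arguments instead of being matched with `with`, so that
-- answer-correct can case on them: `with any? …` finds nothing to abstract once the goal
-- has normalised the searched predicate.
inClassAnswer : ∀ {n} (M : Fin n → ℕ) a {adj : Row n} →
                Dec (∃ λ b → 0 < lookup adj b × M b ≡ M a) → Maybe (Subset n)
inClassAnswer M a (yes (b , _)) = withRepresentative (any? λ r → toℕ r ≟ M a) (λ r → triple a r b)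
inClassAnswer M a (no _)        = nothing

acrossPairAnswer : ∀ {n} (M : Fin n → ℕ) v w → Dec (M v < M w) → Maybe (Subset n)
acrossPairAnswer M v w (yes _) = withRepresentative (any? λ r → toℕ r ≟ M v) (λ r → triple r v w)
acrossPairAnswer M v w (no _)  = withRepresentative (any? λ r → toℕ r ≟ M w) (λ r → triple r w v)

acrossAnswer : ∀ {n} (M : Fin n → ℕ) v {adj : Row n} →
               Dec (∃ λ w → lookup adj w ≡ 0 × M w ≢ M v) → Maybe (Subset n)
acrossAnswer M v (yes (w , _)) = acrossPairAnswer M v w (M v <? M w)
acrossAnswer M v (no _)        = nothing

answer : ∀ {n} {M : Fin n → ℕ} {deg int} → Diagnosis M deg int → Row n → Maybe (Subset n)
answer {M = M} (edgeInClass a _)     adj =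
  inClassAnswer M a {adj} (any? λ b → 0 <? lookup adj b ×-dec M b ≟ M a)
answer {M = M} (nonEdgeAcross _ v _) adj =
  acrossAnswer M v {adj} (any? λ w → lookup adj w ≟ 0 ×-dec ¬? (M w ≟ M v))
answer         (multipartite _ _)    _   = nothing

adjacentTo : ∀ {n} {es : List (Edge n)} {t} (adj : Row n) →
             (∀ x → lookup adj x ≡ count (λ u → Adj? es x u ×-dec just t ≟ₘ just u)) →
             ∀ x → 0 < lookup adj x ⇔ Adj es x t
adjacentTo {es = es} {t} adj adjSpec x =
  mk⇔ to (λ x~t → subst (0 <_) (sym (adjSpec x)) (∃⇒count-pos _ t (x~t , refl)))
  where
  to : 0 < lookup adj x → Adj es x t
  to pos with count-pos⇒∃ (λ u → Adj? es x u ×-dec just t ≟ₘ just u) (subst (0 <_) (adjSpec x) pos)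
  ... | u , x~u , t≡u = subst (Adj es x) (sym (just-injective t≡u)) x~u

module _ {n : ℕ} {es : List (Edge n)} (valid : ValidStream es) {M : Fin n → ℕ} {deg int : Row n}
         (labels : ∀ v → ∃ λ r → toℕ r ≡ M v × LeastNonNeighbour es v r)
         (degrees : ∀ v → lookup deg v ≡ count (Adj? es v))
         (inClass : ∀ v → lookup int v ≡ count (λ u → Adj? es v u ×-dec M u ≟ M v)) where

  private
    rep : Fin n → Fin n
    rep v = proj₁ (labels v)

    toℕ-rep : ∀ v → toℕ (rep v) ≡ M v
    toℕ-rep v = proj₁ (proj₂ (labels v))

    rep-least : ∀ v → LeastNonNeighbour es v (rep v)
    rep-least v = proj₂ (proj₂ (labels v))

  inClass-copy : ∀ {a b} → Adj es a b → M b ≡ M a → IsInducedCopy es coP3Adj (triple a (rep a) b)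
  inClass-copy {a} {b} a~b same = coP3-copy (proj₁ valid) a~b (proj₁ (rep-least a)) rep≁b
    where
    rep-same : rep b ≡ rep a
    rep-same = toℕ-injective (trans (toℕ-rep b) (trans same (sym (toℕ-rep a))))
    rep≁b : ¬ Adj es (rep a) b
    rep≁b rep~b = proj₁ (rep-least b) (subst (Adj es b) (sym rep-same) (Adj-sym rep~b))

  across-copy : ∀ {v w} → ¬ Adj es v w → M v < M w → IsInducedCopy es coP3Adj (triple (rep v) v w)
  across-copy {v} {w} v≁w lt = coP3-copy (proj₁ valid) rep~w (proj₁ (rep-least v) ∘ Adj-sym) v≁w
    where
    rep~w : Adj es (rep v) w
    rep~w = Adj-sym (proj₂ (rep-least w) (rep v) (subst₂ _<_ (sym (toℕ-rep v)) (sym (toℕ-rep w)) lt))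

  no-copy : (∀ a u → Adj es a u → M u ≢ M a) → (∀ v u → Adj es v u ⊎ M u ≡ M v) →
            ¬ Σ (Fin 3 → Fin n) (IsInducedCopy es coP3Adj)
  no-copy noEdge covered (f , copy) with coP3-shape copy
  ... | x~y , x≁z , z≁y = noEdge x y x~y (trans (sameClass z y z≁y) (sameClass x z x≁z))
    where
    x = f zero
    z = f (suc zero)
    y = f (suc (suc zero))
    sameClass : ∀ v u → ¬ Adj es v u → M u ≡ M v
    sameClass v u v≁u = Sum.[ (λ v~u → contradiction v~u v≁u) , id ] (covered v u)

  noEdgeInClass : (∀ a → ¬ 0 < lookup int a) → ∀ a u → Adj es a u → M u ≢ M a
  noEdgeInClass none a u a~u same = none a (subst (0 <_) (sym (inClass a)) (∃⇒count-pos _ u (a~u , same)))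

  covers : (∀ a u → Adj es a u → M u ≢ M a) → ∀ v →
           lookup deg v + classSize M v ≡ n ⇔ (∀ u → Adj es v u ⊎ M u ≡ M v)
  covers noEdge v = mk⇔
    (λ full → count≡n⇒all _ (trans (sym deg+class) full))
    (λ all  → trans deg+class (count-all _ all))
    where
    deg+class : lookup deg v + classSize M v ≡ count (λ u → Adj? es v u ⊎-dec M u ≟ M v)
    deg+class = trans (cong (_+ classSize M v) (degrees v))
                      (sym (count-⊎ (Adj? es v) (λ u → M u ≟ M v) (noEdge v)))

  answer-correct : (d : Diagnosis M deg int) (adj : Row n) →
                   (∀ x → lookup adj x ≡ count (λ u → Adj? es x u ×-dec target d ≟ₘ just u)) →
                   IndSubCorrect coP3Adj es (answer d adj)
  answer-correct (edgeInClass a pos) adj adjSpec = inClassCase (any? _)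
    where
    inClassCase : (s : Dec (∃ λ b → 0 < lookup adj b × M b ≡ M a)) →
                  IndSubCorrect coP3Adj es (inClassAnswer M a {adj} s)
    inClassCase (yes (b , b→a , same)) =
      withRepresentative-correct _ (λ r → triple a r b) (toℕ-rep a)
        (inClass-copy (Adj-sym (Equivalence.to (adjacentTo adj adjSpec b) b→a)) same)
    inClassCase (no none) = λ _ →
      let u , a~u , same = count-pos⇒∃ (λ u → Adj? es a u ×-dec M u ≟ M a) (subst (0 <_) (inClass a) pos)
      in  none (u , Equivalence.from (adjacentTo adj adjSpec u) (Adj-sym a~u) , same)
  answer-correct (nonEdgeAcross none v gap) adj adjSpec = acrossCase (any? _)
    where
    noEdge : ∀ a u → Adj es a u → M u ≢ M a
    noEdge = noEdgeInClass none
    acrossCase : (s : Dec (∃ λ w → lookup adj w ≡ 0 × M w ≢ M v)) →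
                 IndSubCorrect coP3Adj es (acrossAnswer M v {adj} s)
    acrossCase (yes (w , adj0 , differ)) = pairCase (M v <? M w)
      where
      v≁w : ¬ Adj es v w
      v≁w v~w = n≮n 0 (subst (0 <_) adj0 (Equivalence.from (adjacentTo adj adjSpec w) (Adj-sym v~w)))
      pairCase : (s : Dec (M v < M w)) → IndSubCorrect coP3Adj es (acrossPairAnswer M v w s)
      pairCase (yes lt) = withRepresentative-correct _ _ (toℕ-rep v) (across-copy v≁w lt)
      pairCase (no ¬lt) = withRepresentative-correct _ _ (toℕ-rep w)
                            (across-copy (v≁w ∘ Adj-sym) (≤∧≢⇒< (≮⇒≥ ¬lt) differ))
    acrossCase (no none) = λ _ → gap (Equivalence.from (covers noEdge v) covered)
      where
      covered : ∀ u → Adj es v u ⊎ M u ≡ M v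
      covered u with Adj? es v u
      ... | yes v~u = inj₁ v~u
      ... | no  v≁u = inj₂ (decidable-stable (M u ≟ M v) (λ differ → none (u , adj0 , differ)))
        where
        adj0 : lookup adj u ≡ 0
        adj0 = n≤0⇒n≡0 (≮⇒≥ (λ pos → v≁u (Adj-sym (Equivalence.to (adjacentTo adj adjSpec u) pos))))
  answer-correct (multipartite none full) _ _ =
    no-copy (noEdgeInClass none) (λ v → Equivalence.to (covers (noEdgeInClass none) v) (full v))

-- Binary search for the least element outside a decidable set

Brackets : ∀ {n} → (Fin n → Set) → ℕ → ℕ → Set
Brackets P l k = (∀ u → toℕ u < l → P u) × ∃ λ u → ¬ P u × toℕ u < l + 2 ^ k

module BinarySearch (R : ℕ) where

  width : ℕ → ℕ
  width j = 2 ^ (R ∸ suc j)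

  Window : ∀ {n} → ℕ → ℕ → Fin n → Set
  Window j l u = l ≤ toℕ u × toℕ u < l + width j

  window? : ∀ {n} j l (u : Fin n) → Dec (Window j l u)
  window? j l u = (l ≤? toℕ u) ×-dec (toℕ u <? l + width j)

  inWindow? : ∀ {n} {P : Fin n → Set} → Decidable P → ∀ j l u → Dec (P u × Window j l u)
  inWindow? P? j l u = P? u ×-dec window? j l u

  searchStep : ∀ n → ℕ → ℕ → ℕ → ℕ
  searchStep n j c l = if does (c <? count (window? {n} j l)) then l else l + width j

  search : ∀ {n} {P : Fin n → Set} → Decidable P → ℕ → ℕ
  search         P? zero    = 0
  search {n = n} P? (suc j) = searchStep n j (count (inWindow? P? j (search P? j))) (search P? j)

  width-double : ∀ {j} → j < R → 2 ^ (R ∸ j) ≡ width j + width j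
  width-double {j} j<R = trans (cong (2 ^_) (+-∸-assoc 1 j<R)) (cong (width j +_) (+-identityʳ (width j)))

  searchStep-stay : ∀ n j l {c} → c < count (window? {n} j l) → searchStep n j c l ≡ l
  searchStep-stay n j l lt = cong (λ b → if b then l else l + width j) (dec-true (_ <? _) lt)

  searchStep-advance : ∀ n j l {c} → ¬ c < count (window? {n} j l) → searchStep n j c l ≡ l + width j
  searchStep-advance n j l ¬lt = cong (λ b → if b then l else l + width j) (dec-false (_ <? _) ¬lt)

  searchStep-brackets : ∀ {n} {P : Fin n → Set} (P? : Decidable P) {j l} → j < R →
    Brackets P l (R ∸ j) → Brackets P (searchStep n j (count (inWindow? P? j l)) l) (R ∸ suc j)
  searchStep-brackets {n} {P} P? {j} {l} j<R (below , w , ¬Pw , w<)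
    with count (inWindow? P? j l) <? count (window? {n} j l)
  ... | yes lt =
    let u , inWindow , ¬P×inWindow = count-<⇒∃ (inWindow? P? j l) (window? {n} j l) (λ _ → proj₂) lt
    in  subst (λ l′ → Brackets P l′ (R ∸ suc j)) (sym (searchStep-stay n j l lt))
              (below , u , (λ Pu → ¬P×inWindow (Pu , inWindow)) , proj₂ inWindow)
  ... | no ¬lt =
    subst (λ l′ → Brackets P l′ (R ∸ suc j)) (sym (searchStep-advance n j l ¬lt))
          (below′ , w , ¬Pw , w<′)
    where
    below′ : ∀ u → toℕ u < l + width j → P u
    below′ u u< with toℕ u <? l
    ... | yes u<l = below u u<l
    ... | no  u≮l =
      proj₁ (count-≥⇒⊇ (inWindow? P? j l) (window? {n} j l) (λ _ → proj₂) (≮⇒≥ ¬lt) u (≮⇒≥ u≮l , u<))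
    w<′ : toℕ w < l + width j + width j
    w<′ = subst (toℕ w <_) (trans (cong (l +_) (width-double j<R)) (sym (+-assoc l _ _))) w<

  search-brackets : ∀ {n} {P : Fin n → Set} (P? : Decidable P) {v} → n ≤ 2 ^ R → ¬ P v →
                    ∀ j → j ≤ R → Brackets P (search P? j) (R ∸ j)
  search-brackets P? {v} n≤2^R ¬Pv zero    _   = (λ _ ()) , v , ¬Pv , ≤-trans (toℕ<n v) n≤2^R
  search-brackets P?     n≤2^R ¬Pv (suc j) j<R =
    searchStep-brackets P? j<R (search-brackets P? n≤2^R ¬Pv j (<⇒≤ j<R))

  search-least : ∀ {n} {P : Fin n → Set} (P? : Decidable P) {v} → n ≤ 2 ^ R → ¬ P v →
                 ∃ λ r → toℕ r ≡ search P? R × ¬ P r × (∀ u → toℕ u < toℕ r → P u)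
  search-least P? n≤2^R ¬Pv with search-brackets P? n≤2^R ¬Pv R ≤-refl
  ... | below , r , ¬Pr , r< =
    r , ≤-antisym r≤ (≮⇒≥ (¬Pr ∘ below r)) , ¬Pr , λ u u<r → below u (<-≤-trans u<r r≤)
    where
    r≤ : toℕ r ≤ search P? R
    r≤ = m<1+n⇒m≤n (subst (toℕ r <_) (+-comm (search P? R) 1)
                              (subst (λ k → toℕ r < search P? R + 2 ^ k) (n∸n≡0 R) r<))

module CoP3Algorithm (n R : ℕ) (n≤2^R : n ≤ 2 ^ R) where
  open BinarySearch R

  m : ℕ
  m = 3 + R

  -- keepRows makes windowStart j depend on the rows of passes < j only.
  windowStart : ℕ → Table n m → Fin n → ℕ
  windowStart zero    T v = 0
  windowStart (suc j) T v = searchStep n j (lookup (row j T) v) (windowStart j (keepRows j T) v)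

  label : Table n m → Fin n → ℕ
  label T = windowStart R (keepRows R T)

  diagnosis : (T : Table n m) → Diagnosis (label T) (row R T) (row (1 + R) T)
  diagnosis T = diagnose (label T) (row R T) (row (1 + R) T)

  FinalQuery : ℕ → Table n m → Fin n → Fin n → Set
  FinalQuery zero          T v u = ⊤
  FinalQuery (suc zero)    T v u = label T u ≡ label T v
  FinalQuery (suc (suc _)) T v u = target (diagnosis T) ≡ just u

  finalQuery? : ∀ k T v u → Dec (FinalQuery k T v u)
  finalQuery? zero          T v u = yes tt
  finalQuery? (suc zero)    T v u = label T u ≟ label T v
  finalQuery? (suc (suc _)) T v u = target (diagnosis T) ≟ₘ just u

  Query : ℕ → Table n m → Fin n → Fin n → Set
  Query j T v u = if j <ᵇ R then Window j (windowStart j T v) u else FinalQuery (j ∸ R) T v u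

  query? : ∀ j T v u → Dec (Query j T v u)
  query? j T v u with j <ᵇ R
  ... | true  = window? j (windowStart j T v) u
  ... | false = finalQuery? (j ∸ R) T v u

  query-search : ∀ {j T v u} → j < R → Query j T v u ≡ Window j (windowStart j T v) u
  query-search {j} {T} {v} {u} j<R =
    cong (λ b → if b then Window j (windowStart j T v) u else FinalQuery (j ∸ R) T v u) (dec-true (j <? R) j<R)

  query-final : ∀ k {T v u} → Query (k + R) T v u ≡ FinalQuery k T v u
  query-final k {T} {v} {u} = trans
    (cong (λ b → if b then Window (k + R) (windowStart (k + R) T v) u else FinalQuery (k + R ∸ R) T v u)
          (dec-false (k + R <? R) (≤⇒≯ (m≤n+m R k))))
    (cong (λ i → FinalQuery i T v u) (m+n∸n≡m k R))

  open CountingPasses query?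

  verdict : Table n m → Maybe (Subset n)
  verdict T = answer (diagnosis T) (row (2 + R) T)

  n<2^[1+R] : n < 2 ^ suc R
  n<2^[1+R] = ≤-<-trans n≤2^R (^-monoʳ-< 2 (s≤s (s≤s z≤n)) (n<1+n R))

  coP3Algorithm : StreamAlg n (m * (n * suc R))
  coP3Algorithm = algorithm n<2^[1+R] verdict

  module _ (es : List (Edge n)) (valid : ValidStream es) where

    S : ℕ → Table n m
    S = afterPasses es

    F : Table n m
    F = S m

    lookup-row : ∀ {k} → k < m → ∀ v →
                 lookup (row k F) v ≡ count (λ u → Adj? es v u ×-dec query? k (S k) v u)
    lookup-row k<m v = trans (cong (λ r → lookup r v) (row-afterPasses es k<m k<m)) (lookup∘tabulate _ v)

    windowStart-search : ∀ j → j ≤ R → ∀ v → windowStart j (S j) v ≡ search (Adj? es v) j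
    windowStart-search zero    _   v = refl
    windowStart-search (suc j) j<R v = cong₂ (searchStep n j) window-count windowStart-previous
      where
      windowStart-previous : windowStart j (keepRows j (S (suc j))) v ≡ search (Adj? es v) j
      windowStart-previous = trans (cong (λ T → windowStart j T v) (keepRows-afterPasses es (n≤1+n j)))
                                   (windowStart-search j (<⇒≤ j<R) v)
      window-count : lookup (row j (S (suc j))) v ≡ count (inWindow? (Adj? es v) j (search (Adj? es v) j))
      window-count = begin
        lookup (row j (S (suc j))) v
          ≡⟨ cong (λ r → lookup r v) (row-afterPasses es (n<1+n j) (≤-trans j<R (m≤n+m R 3))) ⟩
        lookup (neighbourCounts es (query? j (S j))) v
          ≡⟨ lookup∘tabulate _ v ⟩
        count (λ u → Adj? es v u ×-dec query? j (S j) v u)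
          ≡⟨ count-≡ _ _ (λ u → cong (Adj es v u ×_) (query-search j<R)) ⟩
        count (inWindow? (Adj? es v) j (windowStart j (S j) v))
          ≡⟨ cong (λ l → count (inWindow? (Adj? es v) j l)) (windowStart-search j (<⇒≤ j<R) v) ⟩
        count (inWindow? (Adj? es v) j (search (Adj? es v) j)) ∎
        where open ≡-Reasoning

    label-stable : ∀ {j} → R ≤ j → label (S j) ≡ windowStart R (S R)
    label-stable R≤j = cong (windowStart R) (keepRows-afterPasses es R≤j)

    labels : ∀ v → ∃ λ r → toℕ r ≡ label F v × LeastNonNeighbour es v r
    labels v =
      let r , r≡ , least = search-least (Adj? es v) n≤2^R (Adj-irrefl (proj₁ valid) v)
      in  r , trans r≡ (sym (trans (cong (λ M → M v) (label-stable (m≤n+m R 3))) (windowStart-search R ≤-refl v)))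
            , least

    final-count : ∀ k → k < 3 → ∀ v →
                  lookup (row (k + R) F) v ≡ count (λ u → Adj? es v u ×-dec finalQuery? k (S (k + R)) v u)
    final-count k k<3 v =
      trans (lookup-row (+-monoˡ-< R k<3) v) (count-≡ _ _ (λ u → cong (Adj es v u ×_) (query-final k)))

    degrees : ∀ v → lookup (row R F) v ≡ count (Adj? es v)
    degrees v = trans (final-count 0 (s≤s z≤n) v) (count-⇔ _ (Adj? es v) (λ u → mk⇔ proj₁ (_, tt)))

    inClass : ∀ v → lookup (row (1 + R) F) v ≡ count (λ u → Adj? es v u ×-dec label F u ≟ label F v)
    inClass v = trans (final-count 1 (s≤s (s≤s z≤n)) v)
      (count-≡ _ _ (λ u → cong (λ M → Adj es v u × M u ≡ M v)
                              (trans (label-stable (n≤1+n R)) (sym (label-stable (m≤n+m R 3))))))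

    towardsTarget : ∀ x → lookup (row (2 + R) F) x ≡
                          count (λ u → Adj? es x u ×-dec target (diagnosis F) ≟ₘ just u)
    towardsTarget x = trans (final-count 2 ≤-refl x)
      (count-≡ _ _ (λ u → cong (λ t → Adj es x u × t ≡ just u) same-target))
      where
      rows-stable : ∀ {k} → k < 2 + R → row k (S (2 + R)) ≡ row k F
      rows-stable {k} k< = trans (row-afterPasses es k< k<m) (sym (row-afterPasses es k<m k<m))
        where
        k<m : k < m
        k<m = <-trans k< (n<1+n _)
      same-target : target (diagnosis (S (2 + R))) ≡ target (diagnosis F)
      same-target = trans
        (cong₂ (λ M deg → target (diagnose M deg (row (1 + R) (S (2 + R)))))
               (trans (label-stable (m≤n+m R 2)) (sym (label-stable (m≤n+m R 3))))
               (rows-stable (m≤n+m (suc R) 1)))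
        (cong (λ int → target (diagnose (label F) (row R F) int)) (rows-stable ≤-refl))

    verdict-correct : IndSubCorrect coP3Adj es (verdict F)
    verdict-correct = answer-correct valid labels degrees inClass (diagnosis F) (row (2 + R) F) towardsTarget

  coP3Algorithm-solves : Solves coP3Adj coP3Algorithm m
  coP3Algorithm-solves es valid =
    subst (IndSubCorrect coP3Adj es) (sym (algorithm-result n<2^[1+R] verdict es valid)) (verdict-correct es valid)

n≤2^⌈log2⌉ : ∀ n (rec : Acc _<_ n) → n ≤ 2 ^ ⌈log2⌉ n rec
n≤2^⌈log2⌉ zero          _        = z≤n
n≤2^⌈log2⌉ (suc zero)    _        = ≤-refl
n≤2^⌈log2⌉ (suc (suc n)) (acc rs) = begin
  2 + n                        ≡⟨ ⌊n/2⌋+⌈n/2⌉≡n (2 + n) ⟨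
  ⌊ 2 + n /2⌋ + ⌈ 2 + n /2⌉    ≤⟨ +-monoˡ-≤ _ (⌊n/2⌋≤⌈n/2⌉ (2 + n)) ⟩
  ⌈ 2 + n /2⌉ + ⌈ 2 + n /2⌉    ≤⟨ +-mono-≤ half≤ (≤-trans half≤ (≤-reflexive (sym (+-identityʳ _)))) ⟩
  2 ^ ⌈log2⌉ (2 + n) (acc rs)  ∎
  where
  open ≤-Reasoning
  half≤ : ⌈ 2 + n /2⌉ ≤ 2 ^ ⌈log2⌉ (suc ⌈ n /2⌉) (rs (⌈n/2⌉<n n))
  half≤ = n≤2^⌈log2⌉ (suc ⌈ n /2⌉) (rs (⌈n/2⌉<n n))

n≤2^⌈log₂n⌉ : ∀ n → n ≤ 2 ^ ⌈log₂ n ⌉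
n≤2^⌈log₂n⌉ n = n≤2^⌈log2⌉ n _

passes-bound : ∀ {R} → 1 ≤ R → 3 + R ≤ 8 * R
passes-bound {R} 1≤R = begin
  3 + R       ≤⟨ +-monoˡ-≤ R (*-monoʳ-≤ 3 1≤R) ⟩
  3 * R + R   ≡⟨ +-comm (3 * R) R ⟩
  4 * R       ≤⟨ *-monoˡ-≤ R (m≤m+n 4 4) ⟩
  8 * R       ∎
  where open ≤-Reasoning

space-bound : ∀ {R} n → 1 ≤ R → (3 + R) * (n * suc R) ≤ 8 * n * R ^ 2
space-bound {R} n 1≤R = begin
  (3 + R) * (n * (1 + R))
    ≤⟨ *-mono-≤ (+-monoˡ-≤ R (*-monoʳ-≤ 3 1≤R)) (*-monoʳ-≤ n (+-monoˡ-≤ R 1≤R)) ⟩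
  (3 * R + R) * (n * (R + R))
    ≡⟨ solve 2 (λ R n → (con 3 :* R :+ R) :* (n :* (R :+ R)) := con 8 :* n :* (R :^ 2)) refl R n ⟩
  8 * n * R ^ 2
    ∎
  where open ≤-Reasoning

corollary26 : Σ ℕ λ c → Σ ℕ λ k → Σ ℕ λ N → ∀ (n : ℕ) → N ≤ n →
    Σ ℕ λ p → (p ≤ c * ⌈log₂ n ⌉) × Σ ℕ λ s → (s ≤ c * n * (⌈log₂ n ⌉ ^ k)) ×
      Σ (StreamAlg n s) λ A → Solves coP3Adj A p
corollary26 = 8 , 2 , 2 , λ n 2≤n →
  let open CoP3Algorithm n ⌈log₂ n ⌉ (n≤2^⌈log₂n⌉ n)
  in  m , passes-bound (⌈log₂⌉-mono-≤ 2≤n) , _ , space-bound n (⌈log₂⌉-mono-≤ 2≤n)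
        , coP3Algorithm , coP3Algorithm-solves
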